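{- For $n\ge0$, let $b_n$ be the number of permutations of $[n]$ (the empty permutation for $n=0$) avoiding $2413$, $3142$ and the partially ordered pattern $P_4$. Then $\sum_{n\ge0}b_nx^n=\frac{1-3x+2x^2}{1-4x+4x^2-2x^3+2x^4}$.
   Context: A permutation avoids a classical pattern $p$ if it has no subsequence order-isomorphic to $p$. A permutation $\pi$ avoids the partially ordered pattern $P_4$ iff there are no indices $i_1<i_2<i_3<i_4$ with $\pi_{i_j}<\pi_{i_4}$ for $j=1,2,3$. -}

module Defs where

open import Data.Nat using (ℕ; zero; suc; _∸_)
open import Data.Integer using (ℤ; +_; -_; _+_; _*_)
open import Data.Fin using (Fin; _<_; _<?_)
open import Data.Fin.Properties using (any?; all?)
open import Data.Vec using (Vec; []; _∷_; lookup)
open import Data.List using (List; []; _∷_; concatMap; map; filter; length; allFin; foldr; upTo)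
open import Data.Product using (Σ; ∃; _×_; _,_)
open import Relation.Nullary using (¬_; Dec)
open import Relation.Nullary.Decidable using (_×-dec_; ¬?; _→-dec_)
open import Relation.Binary.PropositionalEquality using (_≡_)
open import Data.Fin using (_≟_)

-- Permutations of [n] (0-indexed as Fin n), in one-line notation
-- π = (π 0, …, π (n-1)) as a vector of length n with distinct entries.

IsPerm : ∀ {n} → Vec (Fin n) n → Set
IsPerm {n} π = ∀ (i j : Fin n) → lookup π i ≡ lookup π j → i ≡ j

Contains2413 : ∀ {n} → Vec (Fin n) n → Set
Contains2413 {n} π = Σ (Fin n) λ i1 → Σ (Fin n) λ i2 → Σ (Fin n) λ i3 → Σ (Fin n) λ i4 →
  (i1 < i2 × i2 < i3 × i3 < i4) ×
  (lookup π i3 < lookup π i1 × lookup π i1 < lookup π i4 × lookup π i4 < lookup π i2)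

Contains3142 : ∀ {n} → Vec (Fin n) n → Set
Contains3142 {n} π = Σ (Fin n) λ i1 → Σ (Fin n) λ i2 → Σ (Fin n) λ i3 → Σ (Fin n) λ i4 →
  (i1 < i2 × i2 < i3 × i3 < i4) ×
  (lookup π i2 < lookup π i4 × lookup π i4 < lookup π i1 × lookup π i1 < lookup π i3)

ContainsP4 : ∀ {n} → Vec (Fin n) n → Set
ContainsP4 {n} π = Σ (Fin n) λ i1 → Σ (Fin n) λ i2 → Σ (Fin n) λ i3 → Σ (Fin n) λ i4 →
  (i1 < i2 × i2 < i3 × i3 < i4) ×
  (lookup π i1 < lookup π i4 × lookup π i2 < lookup π i4 × lookup π i3 < lookup π i4)

Good : ∀ {n} → Vec (Fin n) n → Set
Good π = IsPerm π × ¬ Contains2413 π × ¬ Contains3142 π × ¬ ContainsP4 π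

isPerm? : ∀ {n} (π : Vec (Fin n) n) → Dec (IsPerm π)
isPerm? π = all? λ i → all? λ j → (lookup π i ≟ lookup π j) →-dec (i ≟ j)

c2413? : ∀ {n} (π : Vec (Fin n) n) → Dec (Contains2413 π)
c2413? π = any? λ i1 → any? λ i2 → any? λ i3 → any? λ i4 →
  ((i1 <? i2) ×-dec (i2 <? i3) ×-dec (i3 <? i4)) ×-dec
  ((lookup π i3 <? lookup π i1) ×-dec (lookup π i1 <? lookup π i4) ×-dec (lookup π i4 <? lookup π i2))

c3142? : ∀ {n} (π : Vec (Fin n) n) → Dec (Contains3142 π)
c3142? π = any? λ i1 → any? λ i2 → any? λ i3 → any? λ i4 →
  ((i1 <? i2) ×-dec (i2 <? i3) ×-dec (i3 <? i4)) ×-dec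
  ((lookup π i2 <? lookup π i4) ×-dec (lookup π i4 <? lookup π i1) ×-dec (lookup π i1 <? lookup π i3))

cP4? : ∀ {n} (π : Vec (Fin n) n) → Dec (ContainsP4 π)
cP4? π = any? λ i1 → any? λ i2 → any? λ i3 → any? λ i4 →
  ((i1 <? i2) ×-dec (i2 <? i3) ×-dec (i3 <? i4)) ×-dec
  ((lookup π i1 <? lookup π i4) ×-dec (lookup π i2 <? lookup π i4) ×-dec (lookup π i3 <? lookup π i4))

good? : ∀ {n} (π : Vec (Fin n) n) → Dec (Good π)
good? π = isPerm? π ×-dec ¬? (c2413? π) ×-dec ¬? (c3142? π) ×-dec ¬? (cP4? π)

allVecs : (n k : ℕ) → List (Vec (Fin n) k)
allVecs n zero = [] ∷ []
allVecs n (suc k) = concatMap (λ x → map (x ∷_) (allVecs n k)) (allFin n)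

b : ℕ → ℕ
b n = length (filter good? (allVecs n n))

Series : Set
Series = ℕ → ℤ

_⋆_ : Series → Series → Series
(f ⋆ g) n = foldr _+_ (+ 0) (map (λ k → f k * g (n ∸ k)) (upTo (suc n)))

B : Series
B n = + (b n)

num : Series
num 0 = + 1
num 1 = - (+ 3)
num 2 = + 2
num _ = + 0

den : Series
den 0 = + 1
den 1 = - (+ 4)
den 2 = + 4
den 3 = - (+ 2)
den 4 = + 2
den _ = + 0

-- Reading a permutation backwards exchanges 2413 and 3142 and turns P4 into
-- firstMax (the first of four entries exceeds the other three), so b n also counts the
-- permutations avoiding 3142, 2413 and firstMax. Such a permutation starts with 0, 1
-- or 2, and deleting its first entry leaves another one; conversely, whether a new
-- first entry 0, 1 or 2 may be put in front of one of them depends only on which of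
-- four classes it lies in, and so does the class of the result. This generating tree
-- has a 4 × 4 transfer matrix whose characteristic polynomial, read backwards, is the
-- denominator 1 - 4x + 4x² - 2x³ + 2x⁴; the numerator comes from b 0, …, b 3.

module Submission where

open import Defs
open import Data.Empty using (⊥; ⊥-elim)
open import Data.Fin using (Fin; zero; suc; _<_; _≤_; toℕ; opposite; punchIn; punchOut; fromℕ<)
open import Data.Fin.Properties
  using ( _≟_; _<?_; <-cmp; <-trans; <⇒≢; toℕ<n; toℕ-injective; toℕ-fromℕ<; suc-injective
        ; any?; pigeonhole; opposite-prop; opposite-involutive
        ; punchIn-injective; punchInᵢ≢i; punchOut-injective; punchIn-punchOut )
open import Data.Integer as ℤ using (ℤ; +_; -_; _-_)
import Data.Integer.Properties as ℤ
open import Data.Integer.Tactic.RingSolver using (solve-∀)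
open import Data.List
  using (List; []; _∷_; _++_; map; concatMap; length; foldr; filter; allFin; applyUpTo; cartesianProductWith)
open import Data.List.Membership.Propositional using (_∈_; find; lose)
open import Data.List.Membership.Propositional.Properties
  using ( ∈-map⁺; ∈-map⁻; ∈-concatMap⁺; ∈-concatMap⁻; ∈-filter⁺; ∈-filter⁻
        ; ∈-allFin; ∈-cartesianProductWith⁺ )
open import Data.List.Membership.Propositional.Properties.WithK using (unique∧set⇒bag)
open import Data.List.Properties using (length-map; length-++; map-cong)
open import Data.List.Relation.Binary.BagAndSetEquality using (∼bag⇒↭)
open import Data.List.Relation.Binary.Permutation.Propositional.Properties using (↭-length)
open import Data.List.Relation.Unary.All as All using ([]; _∷_)
open import Data.List.Relation.Unary.AllPairs using ([]; _∷_)
open import Data.List.Relation.Unary.Any using (here; there)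
open import Data.List.Relation.Unary.Unique.Propositional using (Unique)
open import Data.List.Relation.Unary.Unique.Propositional.Properties
  using (++⁺; map⁺; filter⁺; allFin⁺; cartesianProductWith⁺)
open import Data.Nat as ℕ using (ℕ; zero; suc; z≤n; s≤s; z<s; s<s)
open import Data.Nat.ListAction using (sum)
import Data.Nat.Properties as ℕ
open import Data.Nat.Solver using (module +-*-Solver)
open import Data.Product using (Σ; _×_; _,_; proj₁; proj₂)
open import Data.Sum using (_⊎_; inj₁; inj₂; [_,_])
open import Data.Vec as Vec using (Vec; []; _∷_; lookup; tabulate)
open import Data.Vec.Properties
  using ( lookup∘tabulate; lookup-map; tabulate-cong; tabulate∘lookup; tabulate-∘
        ; ∷-injective; ∷-injectiveˡ; ∷-injectiveʳ )
open import Function using (_∘_; _⇔_; mk⇔; Equivalence)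
open import Relation.Binary.Definitions using (tri<; tri≈; tri>)
open import Relation.Binary.PropositionalEquality hiding ([_])
open import Relation.Nullary using (¬_; Dec; yes; no)
open import Relation.Nullary.Decidable using (_×-dec_)

private
  variable
    n : ℕ

map-injective : ∀ {m} {A B : Set} {f : A → B} → (∀ {x y} → f x ≡ f y → x ≡ y) →
                {xs ys : Vec A m} → Vec.map f xs ≡ Vec.map f ys → xs ≡ ys
map-injective f-inj {[]}     {[]}     _  = refl
map-injective f-inj {x ∷ xs} {y ∷ ys} eq =
  cong₂ _∷_ (f-inj (∷-injectiveˡ eq)) (map-injective f-inj (∷-injectiveʳ eq))

concatMap-unique : {A B : Set} (f : A → List B) {xs : List A} → Unique xs → (∀ x → Unique (f x)) →
                   (∀ {x x′ y} → x ∈ xs → x′ ∈ xs → y ∈ f x → y ∈ f x′ → x ≡ x′) →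
                   Unique (concatMap f xs)
concatMap-unique f {[]}     _               _      _    = []
concatMap-unique f {x ∷ xs} (x∉xs ∷ unique) f-uniq same =
  ++⁺ (f-uniq x) (concatMap-unique f unique f-uniq λ p q → same (there p) (there q)) disjoint
  where
  disjoint : ∀ {y} → ¬ (y ∈ f x × y ∈ concatMap f xs)
  disjoint (y∈fx , y∈rest) with find (∈-concatMap⁻ f {xs = xs} y∈rest)
  ... | x′ , x′∈xs , y∈fx′ = All.lookup x∉xs x′∈xs (same (here refl) (there x′∈xs) y∈fx y∈fx′)

length-concatMap : {A B : Set} (f : A → List B) (xs : List A) →
                   length (concatMap f xs) ≡ sum (map (length ∘ f) xs)
length-concatMap f []       = refl
length-concatMap f (x ∷ xs) = trans (length-++ (f x)) (cong (length (f x) ℕ.+_) (length-concatMap f xs))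

length-unique-⇔ : {A : Set} {xs ys : List A} → Unique xs → Unique ys →
                  (∀ {z} → z ∈ xs ⇔ z ∈ ys) → length xs ≡ length ys
length-unique-⇔ unique-xs unique-ys same = ↭-length (∼bag⇒↭ (unique∧set⇒bag unique-xs unique-ys same))

allVecs-cartesian : ∀ m k → allVecs m (suc k) ≡ cartesianProductWith _∷_ (allFin m) (allVecs m k)
allVecs-cartesian m k = go (allFin m)
  where
  go : ∀ xs → concatMap (λ x → map (x ∷_) (allVecs m k)) xs ≡ cartesianProductWith _∷_ xs (allVecs m k)
  go []       = refl
  go (x ∷ xs) = cong (map (x ∷_) (allVecs m k) ++_) (go xs)

allVecs-unique : ∀ m k → Unique (allVecs m k)
allVecs-unique m zero    = [] ∷ []
allVecs-unique m (suc k) rewrite allVecs-cartesian m k =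
  cartesianProductWith⁺ _∷_ ∷-injective (allFin⁺ m) (allVecs-unique m k)

∈-allVecs : ∀ m k (w : Vec (Fin m) k) → w ∈ allVecs m k
∈-allVecs m zero    []      = here refl
∈-allVecs m (suc k) (x ∷ w) rewrite allVecs-cartesian m k =
  ∈-cartesianProductWith⁺ _∷_ (∈-allFin x) (∈-allVecs m k w)

infix 8 _!_
_!_ : (Fin n → Fin n) → Fin n → ℕ
g ! i = toℕ (g i)

opposite-anti : {i j : Fin n} → i < j → opposite j < opposite i
opposite-anti {n} {i} {j} i<j rewrite opposite-prop i | opposite-prop j =
  ℕ.∸-monoʳ-< {m = n} (s≤s i<j) (toℕ<n j)

opposite-injective : {i j : Fin n} → opposite i ≡ opposite j → i ≡ j
opposite-injective {i = i} {j} eq =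
  trans (sym (opposite-involutive i)) (trans (cong opposite eq) (opposite-involutive j))

reverse : {A : Set} → Vec A n → Vec A n
reverse π = tabulate (lookup π ∘ opposite)

lookup-reverse : {A : Set} (π : Vec A n) → ∀ i → lookup (reverse π) i ≡ lookup π (opposite i)
lookup-reverse π = lookup∘tabulate (lookup π ∘ opposite)

reverse-involutive : {A : Set} (π : Vec A n) → reverse (reverse π) ≡ π
reverse-involutive π = trans
  (tabulate-cong λ i → trans (lookup-reverse π (opposite i)) (cong (lookup π) (opposite-involutive i)))
  (tabulate∘lookup π)

reverse-injective : {A : Set} {π ρ : Vec A n} → reverse π ≡ reverse ρ → π ≡ ρ
reverse-injective {π = π} {ρ} eq =
  trans (sym (reverse-involutive π)) (trans (cong reverse eq) (reverse-involutive ρ))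

punchIn-mono-< : ∀ (v : Fin (suc n)) {j k : Fin n} → j < k → punchIn v j < punchIn v k
punchIn-mono-< zero    j<k                         = s<s j<k
punchIn-mono-< (suc v) {zero}  {suc k} _           = z<s
punchIn-mono-< (suc v) {suc j} {suc k} (s<s j<k)   = s<s (punchIn-mono-< v j<k)

punchIn-cancel-< : ∀ (v : Fin (suc n)) {j k : Fin n} → punchIn v j < punchIn v k → j < k
punchIn-cancel-< zero    (s<s j<k)                 = j<k
punchIn-cancel-< (suc v) {zero}  {suc k} _         = z<s
punchIn-cancel-< (suc v) {suc j} {suc k} (s<s p)   = s<s (punchIn-cancel-< v p)

punchIn-<³ : ∀ (v : Fin (suc n)) {a b c d e f : Fin n} →
            (a < b × c < d × e < f) ⇔
            (punchIn v a < punchIn v b × punchIn v c < punchIn v d × punchIn v e < punchIn v f)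
punchIn-<³ v = mk⇔
  (λ (x , y , z) → punchIn-mono-< v x , punchIn-mono-< v y , punchIn-mono-< v z)
  (λ (x , y , z) → punchIn-cancel-< v x , punchIn-cancel-< v y , punchIn-cancel-< v z)

toℕ-punchIn-below : ∀ (v : Fin (suc n)) (j : Fin n) → j < v → toℕ (punchIn v j) ≡ toℕ j
toℕ-punchIn-below (suc v) zero    _         = refl
toℕ-punchIn-below (suc v) (suc j) (s<s j<v) = cong suc (toℕ-punchIn-below v j j<v)

toℕ-punchIn-above : ∀ (v : Fin (suc n)) (j : Fin n) → v ≤ j → toℕ (punchIn v j) ≡ suc (toℕ j)
toℕ-punchIn-above zero    j       _         = refl
toℕ-punchIn-above (suc v) (suc j) (s≤s v≤j) = cong suc (toℕ-punchIn-above v j v≤j)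

punchIn<⇒< : ∀ (v : Fin (suc n)) (j : Fin n) → punchIn v j < v → j < v
punchIn<⇒< (suc v) zero    _       = z<s
punchIn<⇒< (suc v) (suc j) (s<s p) = s<s (punchIn<⇒< v j p)

<punchIn⇒≤ : ∀ (v : Fin (suc n)) (j : Fin n) → v < punchIn v j → v ≤ j
<punchIn⇒≤ zero    j       _       = z≤n
<punchIn⇒≤ (suc v) (suc j) (s<s p) = s≤s (<punchIn⇒≤ v j p)

injective⇒surjective : (g : Fin n → Fin n) → (∀ i j → g i ≡ g j → i ≡ j) →
                       ∀ y → Σ (Fin n) λ x → g x ≡ y
injective⇒surjective {suc n} g inj y with any? (λ x → g x ≟ y)
... | yes hit = hit
... | no miss with pigeonhole (ℕ.n<1+n n) (λ x → punchOut (miss ∘ (x ,_) ∘ sym))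
...   | i , j , i<j , eq = ⊥-elim (<⇒≢ i<j (inj i j (punchOut-injective {i = y} _ _ eq)))

position-of : (g : Fin n → Fin n) → (∀ i j → g i ≡ g j → i ≡ j) →
              ∀ k → k ℕ.< n → Σ (Fin n) λ i → g ! i ≡ k
position-of g inj k k<n with injective⇒surjective g inj (fromℕ< k<n)
... | i , gi≡k = i , trans (cong toℕ gi≡k) (toℕ-fromℕ< k<n)

Triple : (Fin n → Set) → Set
Triple {n} Q = Σ (Fin n) λ a → Σ (Fin n) λ b → Σ (Fin n) λ c → (a < b × b < c) × Q a × Q b × Q c

module _ {Q : Fin n → Set} where

  private
    insert-third : ∀ {a b c} → a < b → c ≢ a → c ≢ b → Q a → Q b → Q c → Triple Q
    insert-third {a} {b} {c} a<b c≢a c≢b qa qb qc with <-cmp c a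
    ... | tri< c<a _ _ = c , a , b , (c<a , a<b) , qc , qa , qb
    ... | tri≈ _ c≡a _ = ⊥-elim (c≢a c≡a)
    ... | tri> _ _ a<c with <-cmp c b
    ...   | tri< c<b _ _ = a , c , b , (a<c , c<b) , qa , qc , qb
    ...   | tri≈ _ c≡b _ = ⊥-elim (c≢b c≡b)
    ...   | tri> _ _ b<c = a , b , c , (a<b , b<c) , qa , qb , qc

  increasing-triple : ∀ {x y z} → x ≢ y → x ≢ z → y ≢ z → Q x → Q y → Q z → Triple Q
  increasing-triple {x} {y} x≢y x≢z y≢z qx qy qz with <-cmp x y
  ... | tri< x<y _ _ = insert-third x<y (≢-sym x≢z) (≢-sym y≢z) qx qy qz
  ... | tri≈ _ x≡y _ = ⊥-elim (x≢y x≡y)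
  ... | tri> _ _ y<x = insert-third y<x (≢-sym y≢z) (≢-sym x≢z) qy qx qz

<2⇒≡0⊎≡1 : ∀ {x} → x ℕ.< 2 → x ≡ 0 ⊎ x ≡ 1
<2⇒≡0⊎≡1 z<s       = inj₁ refl
<2⇒≡0⊎≡1 (s<s z<s) = inj₂ refl

≢0∧≢1⇒2≤ : ∀ {x} → x ≢ 0 → x ≢ 1 → 2 ℕ.≤ x
≢0∧≢1⇒2≤ x≢0 x≢1 = ℕ.≤∧≢⇒< (ℕ.n≢0⇒n>0 x≢0) (≢-sym x≢1)

no-three-below-2 : ∀ {x y z} → x ℕ.< 2 → y ℕ.< 2 → z ℕ.< 2 → x ≢ y → x ≢ z → y ≢ z → ⊥
no-three-below-2 x<2 y<2 z<2 x≢y x≢z y≢z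
  with <2⇒≡0⊎≡1 x<2 | <2⇒≡0⊎≡1 y<2 | <2⇒≡0⊎≡1 z<2
... | inj₁ refl | inj₁ refl | _         = x≢y refl
... | inj₂ refl | inj₂ refl | _         = x≢y refl
... | inj₁ refl | _         | inj₁ refl = x≢z refl
... | inj₂ refl | _         | inj₂ refl = x≢z refl
... | _         | inj₁ refl | inj₁ refl = y≢z refl
... | _         | inj₂ refl | inj₂ refl = y≢z refl

<⇒≢zero : {b c : Fin (suc n)} → b < c → c ≢ zero
<⇒≢zero b<c refl = ℕ.n≮0 b<c

≢zero⇒zero< : {i : Fin (suc n)} → i ≢ zero → zero {n} < i
≢zero⇒zero< {i = zero}  i≢0 = ⊥-elim (i≢0 refl)
≢zero⇒zero< {i = suc i} _   = z<s

clash : ∀ {A : Set} {x a b : ℕ} → x ≡ a → x ≡ b → a ≢ b → A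
clash x≡a x≡b a≢b = ⊥-elim (a≢b (trans (sym x≡a) x≡b))

Shape : Set₁
Shape = ∀ {n} → Fin n → Fin n → Fin n → Fin n → Set

Occurs : Shape → (Fin n → Fin n) → Set
Occurs {n} R g = Σ (Fin n) λ a → Σ (Fin n) λ b → Σ (Fin n) λ c → Σ (Fin n) λ d →
  (a < b × b < c × c < d) × R (g a) (g b) (g c) (g d)

shape2413 shape3142 lastMax firstMax : Shape
shape2413 p q r s = r < p × p < s × s < q
shape3142 p q r s = q < s × s < p × p < r
lastMax   p q r s = p < s × q < s × r < s
firstMax  p q r s = s < p × r < p × q < p

reflect : Shape → Shape
reflect R p q r s = R s r q p

PermAvoiding : Shape → Shape → Shape → (Fin n → Fin n) → Set
PermAvoiding R S T g = (∀ i j → g i ≡ g j → i ≡ j) × ¬ Occurs R g × ¬ Occurs S g × ¬ Occurs T g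

-- Good π unfolds to PermAvoiding shape2413 shape3142 lastMax (lookup π).
GoodRev : (Fin n → Fin n) → Set
GoodRev = PermAvoiding shape3142 shape2413 firstMax

module _ {R : Shape} where

  Occurs-resp : {g h : Fin n → Fin n} → (∀ i → g i ≡ h i) → Occurs R g → Occurs R h
  Occurs-resp {g = g} {h} g≗h (a , b , c , d , abcd , r) =
    a , b , c , d , abcd , subst₄ (g≗h a) (g≗h b) (g≗h c) (g≗h d) r
    where
    subst₄ : ∀ {p q r s p′ q′ r′ s′ : Fin n} → p ≡ p′ → q ≡ q′ → r ≡ r′ → s ≡ s′ →
             R p q r s → R p′ q′ r′ s′
    subst₄ refl refl refl refl x = x

  Occurs-reverse : {g : Fin n → Fin n} → Occurs R (g ∘ opposite) → Occurs (reflect R) g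
  Occurs-reverse (a , b , c , d , (a<b , b<c , c<d) , r) =
    opposite d , opposite c , opposite b , opposite a ,
    (opposite-anti c<d , opposite-anti b<c , opposite-anti a<b) , r

module _ {R S T : Shape} where

  PermAvoiding-resp : {g h : Fin n → Fin n} → (∀ i → g i ≡ h i) →
                      PermAvoiding R S T g → PermAvoiding R S T h
  PermAvoiding-resp g≗h (inj , ¬r , ¬s , ¬t) =
    (λ i j eq → inj i j (trans (g≗h i) (trans eq (sym (g≗h j))))) ,
    ¬r ∘ Occurs-resp {R = R} (sym ∘ g≗h) ,
    ¬s ∘ Occurs-resp {R = S} (sym ∘ g≗h) ,
    ¬t ∘ Occurs-resp {R = T} (sym ∘ g≗h)

  PermAvoiding-reverse : {g : Fin n → Fin n} → PermAvoiding R S T g →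
                         PermAvoiding (reflect R) (reflect S) (reflect T) (g ∘ opposite)
  PermAvoiding-reverse {g = g} (inj , ¬r , ¬s , ¬t) =
    (λ i j eq → opposite-injective (inj _ _ eq)) ,
    ¬r ∘ Occurs-reverse {R = reflect R} {g = g} ,
    ¬s ∘ Occurs-reverse {R = reflect S} {g = g} ,
    ¬t ∘ Occurs-reverse {R = reflect T} {g = g}

GoodRev-resp : {g h : Fin n → Fin n} → (∀ i → g i ≡ h i) → GoodRev g → GoodRev h
GoodRev-resp = PermAvoiding-resp {R = shape3142} {shape2413} {firstMax}

Good⇒GoodRev : (π : Vec (Fin n) n) → Good π → GoodRev (lookup (reverse π))
Good⇒GoodRev π good =
  GoodRev-resp (sym ∘ lookup-reverse π)
    (PermAvoiding-reverse {R = shape2413} {shape3142} {lastMax} good)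

GoodRev⇒Good : (ρ : Vec (Fin n) n) → GoodRev (lookup ρ) → Good (reverse ρ)
GoodRev⇒Good ρ good =
  PermAvoiding-resp {R = shape2413} {shape3142} {lastMax} (sym ∘ lookup-reverse ρ)
    (PermAvoiding-reverse {R = shape3142} {shape2413} {firstMax} good)

-- Prepending a first entry

prepend : Fin (suc n) → (Fin n → Fin n) → Fin (suc n) → Fin (suc n)
prepend v g zero    = v
prepend v g (suc i) = punchIn v (g i)

Leading : Shape → Fin (suc n) → (Fin n → Fin n) → Set
Leading {n} R v g = Σ (Fin n) λ b → Σ (Fin n) λ c → Σ (Fin n) λ d →
  (b < c × c < d) × R v (punchIn v (g b)) (punchIn v (g c)) (punchIn v (g d))

PunchInInvariant : Shape → Set
PunchInInvariant R = ∀ {n} (v : Fin (suc n)) {p q r s : Fin n} →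
  R p q r s ⇔ R (punchIn v p) (punchIn v q) (punchIn v r) (punchIn v s)

shape3142-invariant : PunchInInvariant shape3142
shape3142-invariant v = punchIn-<³ v

shape2413-invariant : PunchInInvariant shape2413
shape2413-invariant v = punchIn-<³ v

firstMax-invariant : PunchInInvariant firstMax
firstMax-invariant v = punchIn-<³ v

module _ {R : Shape} (invariant : PunchInInvariant R) {v : Fin (suc n)} {g : Fin n → Fin n} where

  Occurs-prepend⁺ : Occurs R g → Occurs R (prepend v g)
  Occurs-prepend⁺ (a , b , c , d , (a<b , b<c , c<d) , r) =
    suc a , suc b , suc c , suc d , (s<s a<b , s<s b<c , s<s c<d) , Equivalence.to (invariant v) r

  Occurs-prepend⁻ : Occurs R (prepend v g) → Occurs R g ⊎ Leading R v g
  Occurs-prepend⁻ (zero  , suc b , suc c , suc d , (_ , s<s b<c , s<s c<d) , r) =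
    inj₂ (b , c , d , (b<c , c<d) , r)
  Occurs-prepend⁻ (suc a , suc b , suc c , suc d , (s<s a<b , s<s b<c , s<s c<d) , r) =
    inj₁ (a , b , c , d , (a<b , b<c , c<d) , Equivalence.from (invariant v) r)

module _ {v : Fin (suc n)} {g : Fin n → Fin n} where

  GoodRev-restrict : GoodRev (prepend v g) → GoodRev g
  GoodRev-restrict (inj , ¬r , ¬s , ¬t) =
    (λ i j eq → suc-injective (inj (suc i) (suc j) (cong (punchIn v) eq))) ,
    ¬r ∘ Occurs-prepend⁺ shape3142-invariant ,
    ¬s ∘ Occurs-prepend⁺ shape2413-invariant ,
    ¬t ∘ Occurs-prepend⁺ firstMax-invariant

  GoodRev-prepend : GoodRev g → ¬ Leading shape3142 v g → ¬ Leading shape2413 v g →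
                    ¬ Leading firstMax v g → GoodRev (prepend v g)
  GoodRev-prepend (inj , ¬r , ¬s , ¬t) ¬r′ ¬s′ ¬t′ =
    prepend-injective ,
    ([ ¬r , ¬r′ ] ∘ Occurs-prepend⁻ shape3142-invariant) ,
    ([ ¬s , ¬s′ ] ∘ Occurs-prepend⁻ shape2413-invariant) ,
    ([ ¬t , ¬t′ ] ∘ Occurs-prepend⁻ firstMax-invariant)
    where
    prepend-injective : ∀ i j → prepend v g i ≡ prepend v g j → i ≡ j
    prepend-injective zero    zero    _  = refl
    prepend-injective zero    (suc j) eq = ⊥-elim (punchInᵢ≢i v (g j) (sym eq))
    prepend-injective (suc i) zero    eq = ⊥-elim (punchInᵢ≢i v (g i) eq)
    prepend-injective (suc i) (suc j) eq = cong suc (inj i j (punchIn-injective v _ _ eq))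

-- Three entries smaller than the first one would form a firstMax occurrence.
head≤2 : {g : Fin (suc n) → Fin (suc n)} → GoodRev g → g ! zero ℕ.≤ 2
head≤2 {n} {g} (inj , _ , _ , ¬firstMax) with ℕ.≤-<-connex (g ! zero) 2
... | inj₁ head≤2 = head≤2
... | inj₂ 2<head with smaller 0 z≤n | smaller 1 (s≤s z≤n) | smaller 2 ℕ.≤-refl
  where
  Below : Fin (suc n) → Set
  Below i = zero {n} < i × g i < g zero
  smaller : ∀ k → k ℕ.≤ 2 → Σ (Fin (suc n)) λ i → Below i × g ! i ≡ k
  smaller k k≤2 with position-of g inj k (ℕ.<-trans (ℕ.≤-<-trans k≤2 2<head) (toℕ<n (g zero)))
  ... | zero  , g0≡k = ⊥-elim (ℕ.<-irrefl (sym g0≡k) (ℕ.≤-<-trans k≤2 2<head))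
  ... | suc i , gi≡k = suc i , (z<s , subst (ℕ._< g ! zero) (sym gi≡k) (ℕ.≤-<-trans k≤2 2<head)) , gi≡k
... | x , qx , gx≡0 | y , qy , gy≡1 | z , qz , gz≡2
  with increasing-triple (differ gx≡0 gy≡1 λ ()) (differ gx≡0 gz≡2 λ ()) (differ gy≡1 gz≡2 λ ()) qx qy qz
  where
  differ : ∀ {i j k l} → g ! i ≡ k → g ! j ≡ l → k ≢ l → i ≢ j
  differ gi≡k gj≡l k≢l refl = k≢l (trans (sym gi≡k) gj≡l)
... | a , b , c , (a<b , b<c) , (0<a , ga<g0) , (_ , gb<g0) , (_ , gc<g0) =
  ⊥-elim (¬firstMax (zero , a , b , c , (0<a , a<b , b<c) , (gc<g0 , gb<g0 , ga<g0)))

-- Four classes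

OneSecond : (Fin n → Fin n) → Set
OneSecond {n} g = Σ (Fin n) λ i → toℕ i ≡ 1 × g ! i ≡ 1

ZeroBeforeOne : (Fin n → Fin n) → Set
ZeroBeforeOne {n} g = Σ (Fin n) λ i → Σ (Fin n) λ j → i < j × g ! i ≡ 0 × g ! j ≡ 1

-- start1 also holds the permutations that start with 2 and have 1 before 0:
-- every new first entry treats them like those starting with 1.
data Class : Set where
  start0 start01 start1 start2 : Class

InClass : Class → (Fin (suc n) → Fin (suc n)) → Set
InClass start0  g = g ! zero ≡ 0 × ¬ OneSecond g
InClass start01 g = g ! zero ≡ 0 × OneSecond g
InClass start1  g = g ! zero ≡ 1 ⊎ g ! zero ≡ 2 × ¬ ZeroBeforeOne g
InClass start2  g = g ! zero ≡ 2 × ZeroBeforeOne g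

start1-head≢0 : {g : Fin (suc n) → Fin (suc n)} → InClass start1 g → g ! zero ≢ 0
start1-head≢0 (inj₁ g0≡1)       g0≡0 = ℕ.1+n≢0 (trans (sym g0≡1) g0≡0)
start1-head≢0 (inj₂ (g0≡2 , _)) g0≡0 = ℕ.1+n≢0 (trans (sym g0≡2) g0≡0)

data Head : Set where
  h0 h1 h2 : Head

value : Head → ℕ
value h0 = 0
value h1 = 1
value h2 = 2

data Forbidden : Class → Head → Set where
  start0-h2 : Forbidden start0 h2
  start2-h1 : Forbidden start2 h1

Allowed : Class → Head → Set
Allowed s c = ¬ Forbidden s c

next : Class → Head → Class
next start0  h0 = start01
next start01 h0 = start01
next start1  h0 = start0
next start2  h0 = start0
next _       h1 = start1
next start1  h2 = start1
next _       h2 = start2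

value≤2 : ∀ c → value c ℕ.≤ 2
value≤2 h0 = z≤n
value≤2 h1 = s≤s z≤n
value≤2 h2 = s≤s (s≤s z≤n)

≤2⇒value : ∀ {x} → x ℕ.≤ 2 → Σ Head λ c → x ≡ value c
≤2⇒value z≤n             = h0 , refl
≤2⇒value (s≤s z≤n)       = h1 , refl
≤2⇒value (s≤s (s≤s z≤n)) = h2 , refl

fromValue : ℕ → Head
fromValue 0 = h0
fromValue 1 = h1
fromValue _ = h2

value-injective : ∀ {c c′} → value c ≡ value c′ → c ≡ c′
value-injective {c} {c′} eq = trans (sym (inverse c)) (trans (cong fromValue eq) (inverse c′))
  where
  inverse : ∀ c → fromValue (value c) ≡ c
  inverse h0 = refl
  inverse h1 = refl
  inverse h2 = refl

InClass-resp : ∀ s {g h : Fin (suc n) → Fin (suc n)} → (∀ i → g i ≡ h i) → InClass s g → InClass s h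
InClass-resp s {g} {h} g≗h = by-class s
  where
  !-resp : ∀ {i k} → g ! i ≡ k → h ! i ≡ k
  !-resp {i} = trans (cong toℕ (sym (g≗h i)))
  !-resp⁻ : ∀ {i k} → h ! i ≡ k → g ! i ≡ k
  !-resp⁻ {i} = trans (cong toℕ (g≗h i))
  oneSecond : ∀ {f f′ : Fin (suc n) → Fin (suc n)} → (∀ {i k} → f ! i ≡ k → f′ ! i ≡ k) →
              OneSecond f → OneSecond f′
  oneSecond resp (i , i≡1 , fi≡1) = i , i≡1 , resp fi≡1
  zeroBeforeOne : ∀ {f f′ : Fin (suc n) → Fin (suc n)} → (∀ {i k} → f ! i ≡ k → f′ ! i ≡ k) →
                  ZeroBeforeOne f → ZeroBeforeOne f′
  zeroBeforeOne resp (i , j , i<j , fi≡0 , fj≡1) = i , j , i<j , resp fi≡0 , resp fj≡1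
  by-class : ∀ s → InClass s g → InClass s h
  by-class start0  (g0≡0 , ¬os)       = !-resp g0≡0 , ¬os ∘ oneSecond !-resp⁻
  by-class start01 (g0≡0 , os)        = !-resp g0≡0 , oneSecond !-resp os
  by-class start1  (inj₁ g0≡1)        = inj₁ (!-resp g0≡1)
  by-class start1  (inj₂ (g0≡2 , ¬zb)) = inj₂ (!-resp g0≡2 , ¬zb ∘ zeroBeforeOne !-resp⁻)
  by-class start2  (g0≡2 , zb)        = !-resp g0≡2 , zeroBeforeOne !-resp zb

oneSecond? : (g : Fin n → Fin n) → Dec (OneSecond g)
oneSecond? g = any? λ i → (toℕ i ℕ.≟ 1) ×-dec (g ! i ℕ.≟ 1)

zeroBeforeOne? : (g : Fin n → Fin n) → Dec (ZeroBeforeOne g)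
zeroBeforeOne? g = any? λ i → any? λ j → (i <? j) ×-dec (g ! i ℕ.≟ 0) ×-dec (g ! j ℕ.≟ 1)

classify : {g : Fin (suc n) → Fin (suc n)} → GoodRev g → Σ Class λ s → InClass s g
classify {g = g} good with ≤2⇒value (head≤2 good)
... | h0 , g0≡0 with oneSecond? g
...   | yes oneSecond = start01 , g0≡0 , oneSecond
...   | no ¬oneSecond = start0 , g0≡0 , ¬oneSecond
classify {g = g} good | h1 , g0≡1 = start1 , inj₁ g0≡1
classify {g = g} good | h2 , g0≡2 with zeroBeforeOne? g
...   | yes zb1 = start2 , g0≡2 , zb1
...   | no ¬zb1 = start1 , inj₂ (g0≡2 , ¬zb1)

class-unique : ∀ {s s′ : Class} {g : Fin (suc n) → Fin (suc n)} → InClass s g → InClass s′ g → s ≡ s′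
class-unique {s = start0 } {start0 } _ _ = refl
class-unique {s = start01} {start01} _ _ = refl
class-unique {s = start1 } {start1 } _ _ = refl
class-unique {s = start2 } {start2 } _ _ = refl
class-unique {s = start0 } {start01} (_ , ¬os) (_ , os) = ⊥-elim (¬os os)
class-unique {s = start01} {start0 } (_ , os) (_ , ¬os) = ⊥-elim (¬os os)
class-unique {s = start1 } {start2 } (inj₂ (_ , ¬zb)) (_ , zb) = ⊥-elim (¬zb zb)
class-unique {s = start2 } {start1 } (_ , zb) (inj₂ (_ , ¬zb)) = ⊥-elim (¬zb zb)
class-unique {s = start1 } {start2 } (inj₁ h≡1) (h≡2 , _) = clash h≡1 h≡2 λ ()
class-unique {s = start2 } {start1 } (h≡2 , _) (inj₁ h≡1) = clash h≡1 h≡2 λ ()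
class-unique {s = start0 } {start1 } (h≡0 , _) I = ⊥-elim (start1-head≢0 I h≡0)
class-unique {s = start01} {start1 } (h≡0 , _) I = ⊥-elim (start1-head≢0 I h≡0)
class-unique {s = start1 } {start0 } I (h≡0 , _) = ⊥-elim (start1-head≢0 I h≡0)
class-unique {s = start1 } {start01} I (h≡0 , _) = ⊥-elim (start1-head≢0 I h≡0)
class-unique {s = start0 } {start2 } (h≡0 , _) (h≡2 , _) = clash h≡0 h≡2 λ ()
class-unique {s = start01} {start2 } (h≡0 , _) (h≡2 , _) = clash h≡0 h≡2 λ ()
class-unique {s = start2 } {start0 } (h≡2 , _) (h≡0 , _) = clash h≡0 h≡2 λ ()
class-unique {s = start2 } {start01} (h≡2 , _) (h≡0 , _) = clash h≡0 h≡2 λ ()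

module _ {g : Fin (suc n) → Fin (suc n)} (good : GoodRev g) where

  private
    ¬3142 : ¬ Occurs shape3142 g
    ¬3142 = proj₁ (proj₂ good)
    ¬2413 : ¬ Occurs shape2413 g
    ¬2413 = proj₁ (proj₂ (proj₂ good))

  same-entry : ∀ {i j} → g ! i ≡ g ! j → i ≡ j
  same-entry {i} {j} eq = proj₁ good i j (toℕ-injective eq)

  at-head : ∀ {i k} → g ! zero ≡ k → g ! i ≡ k → i ≡ zero
  at-head g0≡k gi≡k = same-entry (trans gi≡k (sym g0≡k))

  -- The configurations excluded below are what a leading 3142 or 2413 in prepend v g
  -- leaves behind in g; most of them form a 3142 or 2413 together with the head of g.
  head1-forbids-2413 : ∀ {b c d : Fin (suc n)} → g ! zero ≡ 1 → b < c → c < d →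
                       g ! c ≡ 0 → g ! d ℕ.< g ! b → ⊥
  head1-forbids-2413 {zero} {c} {d} g0≡1 _ c<d gc≡0 gd<g0 =
    <⇒≢ c<d (same-entry (trans gc≡0 (sym (ℕ.n<1⇒n≡0 (subst (g ! d ℕ.<_) g0≡1 gd<g0)))))
  head1-forbids-2413 {suc b} {c} {d} g0≡1 b<c c<d gc≡0 gd<gb =
    ¬2413 (zero , suc b , c , d , (z<s , b<c , c<d) , (gc<g0 , g0<gd , gd<gb))
    where
    gc<g0 : g ! c ℕ.< g ! zero
    gc<g0 = subst₂ ℕ._<_ (sym gc≡0) (sym g0≡1) z<s
    g0<gd : g ! zero ℕ.< g ! d
    g0<gd = subst (ℕ._< g ! d) (sym g0≡1) (≢0∧≢1⇒2≤
      (λ gd≡0 → <⇒≢ c<d (same-entry (trans gc≡0 (sym gd≡0))))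
      (λ gd≡1 → <⇒≢zero c<d (at-head g0≡1 gd≡1)))

  head2-forbids-2413 : ∀ {b c d : Fin (suc n)} → g ! zero ≡ 2 → b < c → c < d →
                       g ! c ℕ.< 2 → 2 ℕ.≤ g ! d → g ! d ℕ.< g ! b → ⊥
  head2-forbids-2413 {b} {c} {d} g0≡2 b<c c<d gc<2 2≤gd gd<gb =
    ¬2413 (zero , b , c , d , (≢zero⇒zero< b≢0 , b<c , c<d) , (gc<g0 , g0<gd , gd<gb))
    where
    b≢0 : b ≢ zero
    b≢0 refl = ℕ.<⇒≱ (subst (g ! d ℕ.<_) g0≡2 gd<gb) 2≤gd
    gc<g0 : g ! c ℕ.< g ! zero
    gc<g0 = subst (g ! c ℕ.<_) (sym g0≡2) gc<2
    g0<gd : g ! zero ℕ.< g ! d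
    g0<gd = subst (ℕ._< g ! d) (sym g0≡2)
      (ℕ.≤∧≢⇒< 2≤gd (λ 2≡gd → <⇒≢zero c<d (at-head g0≡2 (sym 2≡gd))))

  head2-forbids-3142 : ∀ {b c d : Fin (suc n)} → g ! zero ≡ 2 → b < c → c < d →
                       g ! b ≡ 0 → g ! d ≡ 1 → 2 ℕ.≤ g ! c → ⊥
  head2-forbids-3142 {b} {c} {d} g0≡2 b<c c<d gb≡0 gd≡1 2≤gc =
    ¬3142 (zero , b , c , d , (≢zero⇒zero< b≢0 , b<c , c<d) , (gb<gd , gd<g0 , g0<gc))
    where
    b≢0 : b ≢ zero
    b≢0 refl = ℕ.0≢1+n (trans (sym gb≡0) g0≡2)
    gb<gd : g ! b ℕ.< g ! d
    gb<gd = subst₂ ℕ._<_ (sym gb≡0) (sym gd≡1) z<s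
    gd<g0 : g ! d ℕ.< g ! zero
    gd<g0 = subst₂ ℕ._<_ (sym gd≡1) (sym g0≡2) (s<s z<s)
    g0<gc : g ! zero ℕ.< g ! c
    g0<gc = subst (ℕ._< g ! c) (sym g0≡2)
      (ℕ.≤∧≢⇒< 2≤gc (λ 2≡gc → <⇒≢zero b<c (at-head g0≡2 (sym 2≡gc))))

  start01-forbids-gap : ∀ {b c d : Fin (suc n)} → InClass start01 g → b < c → c < d →
                        g ! b ≡ 0 → g ! d ≡ 1 → ⊥
  start01-forbids-gap {b} {c} {d} (g0≡0 , i , i≡1 , gi≡1) b<c c<d gb≡0 gd≡1
    with at-head g0≡0 gb≡0 | same-entry (trans gd≡1 (sym gi≡1))
  ... | refl | refl = ℕ.<-irrefl (sym (ℕ.n<1⇒n≡0 (subst (toℕ c ℕ.<_) i≡1 c<d))) b<c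

  start01-forbids-2413 : ∀ {b c d : Fin (suc n)} → InClass start01 g → b < c → c < d →
                         g ! c ℕ.< 2 → g ! d ℕ.< g ! b → ⊥
  start01-forbids-2413 {b} {c} {d} (g0≡0 , i , i≡1 , gi≡1) b<c c<d gc<2 gd<gb
    with <2⇒≡0⊎≡1 gc<2
  ... | inj₁ gc≡0 = <⇒≢zero b<c (at-head g0≡0 gc≡0)
  ... | inj₂ gc≡1 with same-entry (trans gc≡1 (sym gi≡1))
  ...   | refl with toℕ-injective {i = b} {j = zero} (ℕ.n<1⇒n≡0 (subst (toℕ b ℕ.<_) i≡1 b<c))
  ...     | refl = ℕ.n≮0 (subst (g ! d ℕ.<_) g0≡0 gd<gb)

  module _ {v : Fin (suc (suc n))} where

    no-leading-firstMax : toℕ v ℕ.≤ 2 → ¬ Leading firstMax v g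
    no-leading-firstMax v≤2 (b , c , d , (b<c , c<d) , (gd<v , gc<v , gb<v)) =
      no-three-below-2 (below gb<v) (below gc<v) (below gd<v)
        (λ eq → <⇒≢ b<c (same-entry eq))
        (λ eq → <⇒≢ (<-trans b<c c<d) (same-entry eq))
        (λ eq → <⇒≢ c<d (same-entry eq))
      where
      below : ∀ {x} → punchIn v (g x) < v → g ! x ℕ.< 2
      below {x} lt = ℕ.<-≤-trans (punchIn<⇒< v (g x) lt) v≤2

    no-leading-3142 : ∀ {s c} → InClass s g → Allowed s c → toℕ v ≡ value c →
                      ¬ Leading shape3142 v g
    no-leading-3142 {c = h0} _ _ v≡0 (_ , _ , d , _ , (_ , gd<v , _)) =
      ℕ.n≮0 (subst (g ! d ℕ.<_) v≡0 (punchIn<⇒< v (g d) gd<v))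
    no-leading-3142 {c = h1} _ _ v≡1 (b , _ , d , _ , (gb<gd , gd<v , _)) =
      ℕ.n≮0 (subst (g ! b ℕ.<_) (ℕ.n<1⇒n≡0 (subst (g ! d ℕ.<_) v≡1 (punchIn<⇒< v (g d) gd<v)))
                   (punchIn-cancel-< v gb<gd))
    no-leading-3142 {s} {c = h2} I allowed v≡2 (b , c , d , (b<c , c<d) , (gb<gd , gd<v , v<gc)) =
      by-class s I allowed
      where
      gd≡1 : g ! d ≡ 1
      gd≡1 with <2⇒≡0⊎≡1 (subst (g ! d ℕ.<_) v≡2 (punchIn<⇒< v (g d) gd<v))
      ... | inj₁ gd≡0 = ⊥-elim (ℕ.n≮0 (subst (g ! b ℕ.<_) gd≡0 (punchIn-cancel-< v gb<gd)))
      ... | inj₂ gd≡1 = gd≡1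
      gb≡0 : g ! b ≡ 0
      gb≡0 = ℕ.n<1⇒n≡0 (subst (g ! b ℕ.<_) gd≡1 (punchIn-cancel-< v gb<gd))
      2≤gc : 2 ℕ.≤ g ! c
      2≤gc = subst (ℕ._≤ g ! c) v≡2 (<punchIn⇒≤ v (g c) v<gc)
      by-class : ∀ s → InClass s g → Allowed s h2 → ⊥
      by-class start0  _                   allowed = allowed start0-h2
      by-class start01 I                   _       = start01-forbids-gap I b<c c<d gb≡0 gd≡1
      by-class start1  (inj₁ g0≡1)         _       = <⇒≢zero c<d (at-head g0≡1 gd≡1)
      by-class start1  (inj₂ (g0≡2 , _))   _       = head2-forbids-3142 g0≡2 b<c c<d gb≡0 gd≡1 2≤gc
      by-class start2  (g0≡2 , _)          _       = head2-forbids-3142 g0≡2 b<c c<d gb≡0 gd≡1 2≤gc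

    no-leading-2413 : ∀ {s c} → InClass s g → Allowed s c → toℕ v ≡ value c →
                      ¬ Leading shape2413 v g
    no-leading-2413 {c = h0} _ _ v≡0 (_ , c , _ , _ , (gc<v , _ , _)) =
      ℕ.n≮0 (subst (g ! c ℕ.<_) v≡0 (punchIn<⇒< v (g c) gc<v))
    no-leading-2413 {s} {c = h1} I allowed v≡1 (b , c , d , (b<c , c<d) , (gc<v , v<gd , gd<gb′)) =
      by-class s I allowed
      where
      gc≡0 : g ! c ≡ 0
      gc≡0 = ℕ.n<1⇒n≡0 (subst (g ! c ℕ.<_) v≡1 (punchIn<⇒< v (g c) gc<v))
      gd<gb : g ! d ℕ.< g ! b
      gd<gb = punchIn-cancel-< v gd<gb′
      by-class : ∀ s → InClass s g → Allowed s h1 → ⊥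
      by-class start0  (g0≡0 , _)           _       = <⇒≢zero b<c (at-head g0≡0 gc≡0)
      by-class start01 (g0≡0 , _)           _       = <⇒≢zero b<c (at-head g0≡0 gc≡0)
      by-class start1  (inj₁ g0≡1)          _       = head1-forbids-2413 g0≡1 b<c c<d gc≡0 gd<gb
      by-class start1  (inj₂ (g0≡2 , ¬0→1)) _       = head2-forbids-2413 g0≡2 b<c c<d
        (subst (ℕ._< 2) (sym gc≡0) z<s)
        (≢0∧≢1⇒2≤ (λ gd≡0 → <⇒≢ c<d (same-entry (trans gc≡0 (sym gd≡0))))
                  (λ gd≡1 → ¬0→1 (c , d , c<d , gc≡0 , gd≡1)))
        gd<gb
      by-class start2  _                    allowed = allowed start2-h1
    no-leading-2413 {s} {c = h2} I allowed v≡2 (b , c , d , (b<c , c<d) , (gc<v , v<gd , gd<gb′)) =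
      by-class s I allowed
      where
      gc<2 : g ! c ℕ.< 2
      gc<2 = subst (g ! c ℕ.<_) v≡2 (punchIn<⇒< v (g c) gc<v)
      2≤gd : 2 ℕ.≤ g ! d
      2≤gd = subst (ℕ._≤ g ! d) v≡2 (<punchIn⇒≤ v (g d) v<gd)
      gd<gb : g ! d ℕ.< g ! b
      gd<gb = punchIn-cancel-< v gd<gb′
      by-class : ∀ s → InClass s g → Allowed s h2 → ⊥
      by-class start0  _                 allowed = allowed start0-h2
      by-class start01 I                 _       = start01-forbids-2413 I b<c c<d gc<2 gd<gb
      by-class start1  (inj₁ g0≡1)       _ with <2⇒≡0⊎≡1 gc<2
      ... | inj₁ gc≡0 = head1-forbids-2413 g0≡1 b<c c<d gc≡0 gd<gb
      ... | inj₂ gc≡1 = <⇒≢zero b<c (at-head g0≡1 gc≡1)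
      by-class start1  (inj₂ (g0≡2 , _)) _       = head2-forbids-2413 g0≡2 b<c c<d gc<2 2≤gd gd<gb
      by-class start2  (g0≡2 , _)        _       = head2-forbids-2413 g0≡2 b<c c<d gc<2 2≤gd gd<gb

    extend-good : ∀ {s c} → InClass s g → Allowed s c → toℕ v ≡ value c → GoodRev (prepend v g)
    extend-good {c = c} I allowed v≡c = GoodRev-prepend good
      (no-leading-3142 I allowed v≡c) (no-leading-2413 I allowed v≡c)
      (no-leading-firstMax (subst (ℕ._≤ 2) (sym v≡c) (value≤2 c)))

    private
      entry-below : ∀ {i k} → g ! i ≡ k → k ℕ.< toℕ v → prepend v g ! suc i ≡ k
      entry-below {i} gi≡k k<v =
        trans (toℕ-punchIn-below v (g i) (subst (ℕ._< toℕ v) (sym gi≡k) k<v)) gi≡k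

      entry-above : ∀ {i} → toℕ v ℕ.≤ g ! i → prepend v g ! suc i ≡ suc (g ! i)
      entry-above {i} = toℕ-punchIn-above v (g i)

      unshift-below : ∀ {i k} → prepend v g ! suc i ≡ k → k ℕ.< toℕ v → g ! i ≡ k
      unshift-below {i} wi≡k k<v = trans (sym (toℕ-punchIn-below v (g i) gi<v)) wi≡k
        where gi<v = punchIn<⇒< v (g i) (subst (ℕ._< toℕ v) (sym wi≡k) k<v)

      second-is-one : g ! zero ≡ 0 → toℕ v ≡ 0 → OneSecond (prepend v g)
      second-is-one g0≡0 v≡0 =
        suc zero , refl , trans (entry-above (subst (ℕ._≤ g ! zero) (sym v≡0) z≤n)) (cong suc g0≡0)

      second-not-one : toℕ v ≡ 0 → g ! zero ≢ 0 → ¬ OneSecond (prepend v g)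
      second-not-one v≡0 g0≢0 (suc zero , _ , w1≡1) =
        g0≢0 (ℕ.suc-injective (trans (sym (entry-above (subst (ℕ._≤ g ! zero) (sym v≡0) z≤n))) w1≡1))

      zeroBeforeOne⁺ : toℕ v ≡ 2 → ZeroBeforeOne g → ZeroBeforeOne (prepend v g)
      zeroBeforeOne⁺ v≡2 (i , j , i<j , gi≡0 , gj≡1) =
        suc i , suc j , s<s i<j ,
        entry-below gi≡0 (subst (0 ℕ.<_) (sym v≡2) z<s) ,
        entry-below gj≡1 (subst (1 ℕ.<_) (sym v≡2) (s<s z<s))

      zeroBeforeOne⁻ : toℕ v ≡ 2 → ZeroBeforeOne (prepend v g) → ZeroBeforeOne g
      zeroBeforeOne⁻ v≡2 (zero , _ , _ , v≡0 , _) = ⊥-elim (ℕ.0≢1+n (trans (sym v≡0) v≡2))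
      zeroBeforeOne⁻ v≡2 (suc i , suc j , s<s i<j , wi≡0 , wj≡1) =
        i , j , i<j ,
        unshift-below wi≡0 (subst (0 ℕ.<_) (sym v≡2) z<s) ,
        unshift-below wj≡1 (subst (1 ℕ.<_) (sym v≡2) (s<s z<s))

    extend-class : ∀ {s c} → InClass s g → Allowed s c → toℕ v ≡ value c →
                   InClass (next s c) (prepend v g)
    extend-class {start0}  {h0} (g0≡0 , _) _ v≡0 = v≡0 , second-is-one g0≡0 v≡0
    extend-class {start01} {h0} (g0≡0 , _) _ v≡0 = v≡0 , second-is-one g0≡0 v≡0
    extend-class {start1}  {h0} I          _ v≡0 = v≡0 , second-not-one v≡0 (start1-head≢0 I)
    extend-class {start2}  {h0} (g0≡2 , _) _ v≡0 =
      v≡0 , second-not-one v≡0 (λ g0≡0 → ℕ.1+n≢0 (trans (sym g0≡2) g0≡0))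
    extend-class {start0}  {h1} _ _ v≡1 = inj₁ v≡1
    extend-class {start01} {h1} _ _ v≡1 = inj₁ v≡1
    extend-class {start1}  {h1} _ _ v≡1 = inj₁ v≡1
    extend-class {start2}  {h1} _ allowed _ = ⊥-elim (allowed start2-h1)
    extend-class {start0}  {h2} _ allowed _ = ⊥-elim (allowed start0-h2)
    extend-class {start01} {h2} (g0≡0 , i , i≡1 , gi≡1) _ v≡2 =
      v≡2 , zeroBeforeOne⁺ v≡2 (zero , i , subst (0 ℕ.<_) (sym i≡1) z<s , g0≡0 , gi≡1)
    extend-class {start1}  {h2} (inj₁ g0≡1) _ v≡2 =
      inj₂ (v≡2 , λ zb1 → one-first (zeroBeforeOne⁻ v≡2 zb1))
      where
      one-first : ¬ ZeroBeforeOne g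
      one-first (i , j , i<j , _ , gj≡1) = <⇒≢zero i<j (at-head g0≡1 gj≡1)
    extend-class {start1}  {h2} (inj₂ (_ , ¬zb1)) _ v≡2 = inj₂ (v≡2 , ¬zb1 ∘ zeroBeforeOne⁻ v≡2)
    extend-class {start2}  {h2} (_ , zb1) _ v≡2 = v≡2 , zeroBeforeOne⁺ v≡2 zb1

-- The new first entry 2, then 0, the old second entry (now ≥ 3) and 1 form a 3142.
start0-forbids-h2 : {g : Fin (suc n) → Fin (suc n)} {v : Fin (suc (suc n))} →
                    InClass start0 g → toℕ v ≡ 2 → ¬ GoodRev (prepend v g)
start0-forbids-h2 {zero} {v = v} _ v≡2 _ = ℕ.<-irrefl v≡2 (toℕ<n v)
start0-forbids-h2 {suc n} {g} {v} (g0≡0 , ¬oneSecond) v≡2 good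
  with position-of g (proj₁ (GoodRev-restrict good)) 1 (s<s z<s)
... | zero , g0≡1 = ℕ.0≢1+n (trans (sym g0≡0) g0≡1)
... | suc zero , g1≡1 = ¬oneSecond (suc zero , refl , g1≡1)
... | suc (suc p) , gp≡1 =
  proj₁ (proj₂ good) (zero , suc zero , suc (suc zero) , suc (suc (suc p)) ,
    (z<s , s<s z<s , s<s (s<s z<s)) , (w1<wp , wp<w0 , w0<w2))
  where
  same-entry′ : ∀ {i j} → g ! i ≡ g ! j → i ≡ j
  same-entry′ = same-entry (GoodRev-restrict good)
  w1≡0 : toℕ (punchIn v (g zero)) ≡ 0
  w1≡0 = trans (toℕ-punchIn-below v (g zero) (subst₂ ℕ._<_ (sym g0≡0) (sym v≡2) z<s)) g0≡0
  wp≡1 : toℕ (punchIn v (g (suc (suc p)))) ≡ 1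
  wp≡1 = trans (toℕ-punchIn-below v _ (subst₂ ℕ._<_ (sym gp≡1) (sym v≡2) (s<s z<s))) gp≡1
  2≤g1 : 2 ℕ.≤ g ! suc zero
  2≤g1 = ≢0∧≢1⇒2≤ (λ g1≡0 → ℕ.0≢1+n (cong toℕ (same-entry′ (trans g0≡0 (sym g1≡0)))))
                   (λ g1≡1 → ¬oneSecond (suc zero , refl , g1≡1))
  w1<wp : punchIn v (g zero) < punchIn v (g (suc (suc p)))
  w1<wp = subst₂ ℕ._<_ (sym w1≡0) (sym wp≡1) z<s
  wp<w0 : punchIn v (g (suc (suc p))) < v
  wp<w0 = subst₂ ℕ._<_ (sym wp≡1) (sym v≡2) (s<s z<s)
  w0<w2 : v < punchIn v (g (suc zero))
  w0<w2 = subst₂ ℕ._<_ (sym v≡2)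
    (sym (toℕ-punchIn-above v (g (suc zero)) (subst (ℕ._≤ g ! suc zero) (sym v≡2) 2≤g1)))
    (s<s 2≤g1)

-- The new first entry 1, then the old head (now 3), 0 and the old 1 (now 2) form a 2413.
start2-forbids-h1 : {g : Fin (suc n) → Fin (suc n)} {v : Fin (suc (suc n))} →
                    InClass start2 g → toℕ v ≡ 1 → ¬ GoodRev (prepend v g)
start2-forbids-h1 {g = g} {v} (g0≡2 , i , j , i<j , gi≡0 , gj≡1) v≡1 good =
  proj₁ (proj₂ (proj₂ good)) (zero , suc zero , suc i , suc j ,
    (z<s , s<s (≢zero⇒zero< i≢0) , s<s i<j) , (wi<w0 , w0<wj , wj<w1))
  where
  i≢0 : i ≢ zero
  i≢0 refl = ℕ.0≢1+n (trans (sym gi≡0) g0≡2)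
  wi≡0 : toℕ (punchIn v (g i)) ≡ 0
  wi≡0 = trans (toℕ-punchIn-below v (g i) (subst₂ ℕ._<_ (sym gi≡0) (sym v≡1) z<s)) gi≡0
  wj≡2 : toℕ (punchIn v (g j)) ≡ 2
  wj≡2 = trans (toℕ-punchIn-above v (g j) (subst₂ ℕ._≤_ (sym v≡1) (sym gj≡1) ℕ.≤-refl)) (cong suc gj≡1)
  w1≡3 : toℕ (punchIn v (g zero)) ≡ 3
  w1≡3 = trans (toℕ-punchIn-above v (g zero) (subst₂ ℕ._≤_ (sym v≡1) (sym g0≡2) (s≤s z≤n)))
               (cong suc g0≡2)
  wi<w0 : punchIn v (g i) < v
  wi<w0 = subst₂ ℕ._<_ (sym wi≡0) (sym v≡1) z<s
  w0<wj : v < punchIn v (g j)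
  w0<wj = subst₂ ℕ._<_ (sym v≡1) (sym wj≡2) (s<s z<s)
  wj<w1 : punchIn v (g j) < punchIn v (g zero)
  wj<w1 = subst₂ ℕ._<_ (sym wj≡2) (sym w1≡3) ℕ.≤-refl

extension-allowed : ∀ {s c} {g : Fin (suc n) → Fin (suc n)} {v : Fin (suc (suc n))} →
                    GoodRev (prepend v g) → InClass s g → toℕ v ≡ value c → Allowed s c
extension-allowed good I v≡2 start0-h2 = start0-forbids-h2 I v≡2 good
extension-allowed good I v≡1 start2-h1 = start2-forbids-h1 I v≡1 good

-- Enumeration

-- At n = 0 there is no entry 2 to prepend; the junk value is never used,
-- since size-1 permutations only lie in start0, which forbids h2.
letter : Head → Fin (suc (suc n))
letter         h0 = zero
letter         h1 = suc zero
letter {zero}  h2 = suc zero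
letter {suc n} h2 = suc (suc zero)

letter-value : ∀ {s c} {g : Fin (suc n) → Fin (suc n)} → InClass s g → Allowed s c →
               toℕ (letter {n} c) ≡ value c
letter-value                       {c = h0} _ _ = refl
letter-value                       {c = h1} _ _ = refl
letter-value {suc n}               {c = h2} _ _ = refl
letter-value {zero} {s = start0}   {h2} _ allowed = ⊥-elim (allowed start0-h2)
letter-value {zero} {s = start01}  {h2} (_ , zero , () , _)
letter-value {zero} {s = start1}   {h2} {g} I _ = ⊥-elim (start1-head≢0 I (ℕ.n<1⇒n≡0 (toℕ<n (g zero))))
letter-value {zero} {s = start2}   {h2} {g} (g0≡2 , _) _ = clash (ℕ.n<1⇒n≡0 (toℕ<n (g zero))) g0≡2 λ ()

prependV : Fin (suc n) → Vec (Fin n) n → Vec (Fin (suc n)) (suc n)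
prependV v σ = v ∷ Vec.map (punchIn v) σ

lookup-prependV : (v : Fin (suc n)) (σ : Vec (Fin n) n) → ∀ i → lookup (prependV v σ) i ≡ prepend v (lookup σ) i
lookup-prependV v σ zero    = refl
lookup-prependV v σ (suc i) = lookup-map i (punchIn v) σ

prependV-injective : ∀ {v w : Fin (suc n)} {σ ρ : Vec (Fin n) n} →
                     prependV v σ ≡ prependV w ρ → v ≡ w × σ ≡ ρ
prependV-injective {v = v} eq with ∷-injective eq
... | refl , tails = refl , map-injective (punchIn-injective v _ _) tails

prependV-surjective : (v : Fin (suc n)) (rest : Vec (Fin (suc n)) n) → (∀ i → v ≢ lookup rest i) →
                      Σ (Vec (Fin n) n) λ σ → prependV v σ ≡ v ∷ rest
prependV-surjective v rest v∉rest = tabulate (λ i → punchOut (v∉rest i)) , cong (v ∷_) (begin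
  Vec.map (punchIn v) (tabulate (λ i → punchOut (v∉rest i))) ≡⟨ tabulate-∘ (punchIn v) _ ⟨
  tabulate (λ i → punchIn v (punchOut (v∉rest i)))           ≡⟨ tabulate-cong (λ i → punchIn-punchOut (v∉rest i)) ⟩
  tabulate (lookup rest)                                      ≡⟨ tabulate∘lookup rest ⟩
  rest                                                        ∎)
  where open ≡-Reasoning

transitionsInto : Class → List (Class × Head)
transitionsInto start0  = (start1 , h0) ∷ (start2 , h0) ∷ []
transitionsInto start01 = (start0 , h0) ∷ (start01 , h0) ∷ []
transitionsInto start1  = (start0 , h1) ∷ (start01 , h1) ∷ (start1 , h1) ∷ (start1 , h2) ∷ []
transitionsInto start2  = (start01 , h2) ∷ (start2 , h2) ∷ []

∈-transitionsInto⁻ : ∀ {s s′ c} → (s′ , c) ∈ transitionsInto s → Allowed s′ c × next s′ c ≡ s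
∈-transitionsInto⁻ {start0}  (here refl)                         = (λ ()) , refl
∈-transitionsInto⁻ {start0}  (there (here refl))                 = (λ ()) , refl
∈-transitionsInto⁻ {start01} (here refl)                         = (λ ()) , refl
∈-transitionsInto⁻ {start01} (there (here refl))                 = (λ ()) , refl
∈-transitionsInto⁻ {start1}  (here refl)                         = (λ ()) , refl
∈-transitionsInto⁻ {start1}  (there (here refl))                 = (λ ()) , refl
∈-transitionsInto⁻ {start1}  (there (there (here refl)))         = (λ ()) , refl
∈-transitionsInto⁻ {start1}  (there (there (there (here refl)))) = (λ ()) , refl
∈-transitionsInto⁻ {start2}  (here refl)                         = (λ ()) , refl
∈-transitionsInto⁻ {start2}  (there (here refl))                 = (λ ()) , refl

∈-transitionsInto⁺ : ∀ {s c} → Allowed s c → (s , c) ∈ transitionsInto (next s c)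
∈-transitionsInto⁺ {start0}  {h0} _ = here refl
∈-transitionsInto⁺ {start01} {h0} _ = there (here refl)
∈-transitionsInto⁺ {start1}  {h0} _ = here refl
∈-transitionsInto⁺ {start2}  {h0} _ = there (here refl)
∈-transitionsInto⁺ {start0}  {h1} _ = here refl
∈-transitionsInto⁺ {start01} {h1} _ = there (here refl)
∈-transitionsInto⁺ {start1}  {h1} _ = there (there (here refl))
∈-transitionsInto⁺ {start2}  {h1} allowed = ⊥-elim (allowed start2-h1)
∈-transitionsInto⁺ {start0}  {h2} allowed = ⊥-elim (allowed start0-h2)
∈-transitionsInto⁺ {start01} {h2} _ = here refl
∈-transitionsInto⁺ {start1}  {h2} _ = there (there (there (here refl)))
∈-transitionsInto⁺ {start2}  {h2} _ = there (here refl)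

enumerate : (n : ℕ) → Class → List (Vec (Fin (suc n)) (suc n))
enumerate zero    start0 = (zero ∷ []) ∷ []
enumerate zero    _      = []
enumerate (suc n) s      = concatMap (λ (s′ , c) → map (prependV (letter c)) (enumerate n s′)) (transitionsInto s)

∈-enumerate⁻ : ∀ {s} {τ : Vec (Fin (suc (suc n))) (suc (suc n))} → τ ∈ enumerate (suc n) s →
               Σ (Class × Head) λ (s′ , c) → (s′ , c) ∈ transitionsInto s ×
               Σ (Vec (Fin (suc n)) (suc n)) λ σ → σ ∈ enumerate n s′ × τ ≡ prependV (letter c) σ
∈-enumerate⁻ {s = s} τ∈ with find (∈-concatMap⁻ _ {xs = transitionsInto s} τ∈)
... | t , t∈ , τ∈map with ∈-map⁻ _ τ∈map
...   | σ , σ∈ , τ≡ = t , t∈ , σ , σ∈ , τ≡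

∈-enumerate⁺ : ∀ {s s′ c} {σ : Vec (Fin (suc n)) (suc n)} →
               (s′ , c) ∈ transitionsInto s → σ ∈ enumerate n s′ →
               prependV (letter c) σ ∈ enumerate (suc n) s
∈-enumerate⁺ t∈ σ∈ = ∈-concatMap⁺ _ (lose t∈ (∈-map⁺ _ σ∈))

enumerate-sound : ∀ n {s} {τ : Vec (Fin (suc n)) (suc n)} → τ ∈ enumerate n s →
                  GoodRev (lookup τ) × InClass s (lookup τ)
enumerate-sound zero    {start0} (here refl) = single , refl , λ { (zero , () , _) }
  where
  single : GoodRev (lookup (zero ∷ []))
  single = (λ { zero zero _ → refl }) , (λ { (zero , zero , _ , _ , (() , _) , _) })
         , (λ { (zero , zero , _ , _ , (() , _) , _) }) , (λ { (zero , zero , _ , _ , (() , _) , _) })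
enumerate-sound (suc n) {s} τ∈ with ∈-enumerate⁻ {s = s} τ∈
... | (s′ , c) , t∈ , σ , σ∈ , refl with ∈-transitionsInto⁻ {s = s} t∈ | enumerate-sound n σ∈
...   | allowed , refl | good , I =
  GoodRev-resp (sym ∘ lookup-prependV v σ) (extend-good good I allowed v≡c) ,
  InClass-resp (next s′ c) (sym ∘ lookup-prependV v σ) (extend-class good I allowed v≡c)
  where
  v : Fin (suc (suc n))
  v = letter c
  v≡c : toℕ v ≡ value c
  v≡c = letter-value I allowed

enumerate-complete : ∀ n {s} (τ : Vec (Fin (suc n)) (suc n)) → GoodRev (lookup τ) → InClass s (lookup τ) →
                     τ ∈ enumerate n s
enumerate-complete zero (zero ∷ []) _ I with class-unique {s′ = start0} I (refl , λ { (zero , () , _) })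
... | refl = here refl
enumerate-complete (suc n) {s} (v ∷ rest) good I
  with prependV-surjective v rest (λ i eq → ℕ.0≢1+n (cong toℕ (proj₁ good zero (suc i) eq)))
... | σ , refl = subst₂ (λ w t → prependV w σ ∈ enumerate (suc n) t) (sym v≡letter) s≡
                   (∈-enumerate⁺ (∈-transitionsInto⁺ allowed) σ∈)
  where
  good′ : GoodRev (prepend v (lookup σ))
  good′ = GoodRev-resp (lookup-prependV v σ) good
  goodσ : GoodRev (lookup σ)
  goodσ = GoodRev-restrict good′
  s′ : Class
  s′ = proj₁ (classify goodσ)
  Iσ : InClass s′ (lookup σ)
  Iσ = proj₂ (classify goodσ)
  σ∈ : σ ∈ enumerate n s′
  σ∈ = enumerate-complete n σ goodσ Iσ
  c : Head
  c = proj₁ (≤2⇒value (head≤2 good′))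
  v≡c : toℕ v ≡ value c
  v≡c = proj₂ (≤2⇒value (head≤2 good′))
  allowed : Allowed s′ c
  allowed = extension-allowed good′ Iσ v≡c
  v≡letter : v ≡ letter c
  v≡letter = toℕ-injective (trans v≡c (sym (letter-value Iσ allowed)))
  s≡ : next s′ c ≡ s
  s≡ = class-unique (extend-class goodσ Iσ allowed v≡c) (InClass-resp s (lookup-prependV v σ) I)

transitionsInto-unique : ∀ s → Unique (transitionsInto s)
transitionsInto-unique start0  = ((λ ()) ∷ []) ∷ [] ∷ []
transitionsInto-unique start01 = ((λ ()) ∷ []) ∷ [] ∷ []
transitionsInto-unique start1  =
  ((λ ()) ∷ (λ ()) ∷ (λ ()) ∷ []) ∷ ((λ ()) ∷ (λ ()) ∷ []) ∷ ((λ ()) ∷ []) ∷ [] ∷ []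
transitionsInto-unique start2  = ((λ ()) ∷ []) ∷ [] ∷ []

enumerate-unique : ∀ n s → Unique (enumerate n s)
enumerate-unique zero    start0  = [] ∷ []
enumerate-unique zero    start01 = []
enumerate-unique zero    start1  = []
enumerate-unique zero    start2  = []
enumerate-unique (suc n) s       = concatMap-unique _ (transitionsInto-unique s)
  (λ (s′ , c) → map⁺ (proj₂ ∘ prependV-injective) (enumerate-unique n s′)) same-move
  where
  same-move : ∀ {t t′ τ} → t ∈ transitionsInto s → t′ ∈ transitionsInto s →
              τ ∈ map (prependV (letter (proj₂ t))) (enumerate n (proj₁ t)) →
              τ ∈ map (prependV (letter (proj₂ t′))) (enumerate n (proj₁ t′)) → t ≡ t′
  same-move {s′ , c} {_ , c′} t∈ t′∈ τ∈ τ∈′ with ∈-map⁻ _ τ∈ | ∈-map⁻ _ τ∈′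
  ... | σ , σ∈ , refl | σ′ , σ′∈ , eq with prependV-injective eq
  ...   | letters≡ , refl with class-unique (proj₂ (enumerate-sound n σ′∈)) (proj₂ (enumerate-sound n σ∈))
  ...     | refl = cong (s′ ,_) (value-injective (begin
    value c                 ≡⟨ letter-value I (proj₁ (∈-transitionsInto⁻ {s = s} t∈)) ⟨
    toℕ (letter {n} c)      ≡⟨ cong toℕ letters≡ ⟩
    toℕ (letter {n} c′)     ≡⟨ letter-value I (proj₁ (∈-transitionsInto⁻ {s = s} t′∈)) ⟩
    value c′                ∎))
    where
    open ≡-Reasoning
    I : InClass s′ (lookup σ)
    I = proj₂ (enumerate-sound n σ∈)

classes : List Class
classes = start0 ∷ start01 ∷ start1 ∷ start2 ∷ []

classes-unique : Unique classes
classes-unique = ((λ ()) ∷ (λ ()) ∷ (λ ()) ∷ []) ∷ ((λ ()) ∷ (λ ()) ∷ []) ∷ ((λ ()) ∷ []) ∷ [] ∷ []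

∈-classes : ∀ s → s ∈ classes
∈-classes start0  = here refl
∈-classes start01 = there (here refl)
∈-classes start1  = there (there (here refl))
∈-classes start2  = there (there (there (here refl)))

enumerateAll : (n : ℕ) → List (Vec (Fin (suc n)) (suc n))
enumerateAll n = concatMap (enumerate n) classes

b≡length-enumerateAll : ∀ n → b (suc n) ≡ length (enumerateAll n)
b≡length-enumerateAll n = trans
  (length-unique-⇔ (filter⁺ good? (allVecs-unique N N)) (map⁺ reverse-injective unique) (mk⇔ to from))
  (length-map reverse (enumerateAll n))
  where
  N : ℕ
  N = suc n
  unique : Unique (enumerateAll n)
  unique = concatMap-unique (enumerate n) classes-unique (enumerate-unique n)
    λ _ _ τ∈ τ∈′ → class-unique (proj₂ (enumerate-sound n τ∈)) (proj₂ (enumerate-sound n τ∈′))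
  to : ∀ {π} → π ∈ filter good? (allVecs N N) → π ∈ map reverse (enumerateAll n)
  to {π} π∈ = subst (_∈ map reverse (enumerateAll n)) (reverse-involutive π)
    (∈-map⁺ reverse (∈-concatMap⁺ (enumerate n)
      (lose (∈-classes s) (enumerate-complete n (reverse π) goodRev I))))
    where
    goodRev : GoodRev (lookup (reverse π))
    goodRev = Good⇒GoodRev π (proj₂ (∈-filter⁻ good? {xs = allVecs N N} π∈))
    s : Class
    s = proj₁ (classify goodRev)
    I : InClass s (lookup (reverse π))
    I = proj₂ (classify goodRev)
  from : ∀ {π} → π ∈ map reverse (enumerateAll n) → π ∈ filter good? (allVecs N N)
  from π∈ =
    let ρ , ρ∈ , π≡ = ∈-map⁻ reverse π∈
        _ , _ , ρ∈s = find (∈-concatMap⁻ (enumerate n) {xs = classes} ρ∈)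
    in subst (_∈ filter good? (allVecs N N)) (sym π≡)
         (∈-filter⁺ good? (∈-allVecs N N (reverse ρ)) (GoodRev⇒Good ρ (proj₁ (enumerate-sound n ρ∈s))))

-- Transfer matrix

module Transfer {A : Set} (_⊕_ : A → A → A) (𝟘 : A) where

  total : (Class → A) → A
  total q = foldr _⊕_ 𝟘 (map q classes)

  step : (Class → A) → Class → A
  step q s = foldr _⊕_ 𝟘 (map (q ∘ proj₁) (transitionsInto s))

open Transfer ℕ._+_ 0

step^ : ℕ → (Class → ℕ) → Class → ℕ
step^ zero    q = q
step^ (suc k) q = step (step^ k q)

-- Cayley–Hamilton for the transfer matrix, whose reversed characteristic polynomial is
-- 1 - 4x + 4x² - 2x³ + 2x⁴; Transfer is instantiated with the solver's polynomial syntax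
-- so that step can be expanded symbolically.
step-recurrence : ∀ q → total (step^ 4 q) ℕ.+ 4 ℕ.* total (step^ 2 q) ℕ.+ 2 ℕ.* total q
                      ≡ 4 ℕ.* total (step^ 3 q) ℕ.+ 2 ℕ.* total (step^ 1 q)
step-recurrence q =
  solve 4 (λ a b c d → let p = λ { start0 → a ; start01 → b ; start1 → c ; start2 → d } in
      P.total (P.step (P.step (P.step (P.step p)))) :+ con 4 :* P.total (P.step (P.step p)) :+ con 2 :* P.total p
    := con 4 :* P.total (P.step (P.step (P.step p))) :+ con 2 :* P.total (P.step p))
    refl (q start0) (q start01) (q start1) (q start2)
  where
  open +-*-Solver
  module P = Transfer (_:+_ {4}) (con 0)

step-cong : ∀ {q q′ : Class → ℕ} → (∀ s → q s ≡ q′ s) → ∀ s → step q s ≡ step q′ s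
step-cong q≗q′ s = cong sum (map-cong (q≗q′ ∘ proj₁) (transitionsInto s))

total-cong : ∀ {q q′ : Class → ℕ} → (∀ s → q s ≡ q′ s) → total q ≡ total q′
total-cong q≗q′ = cong sum (map-cong q≗q′ classes)

counts : ℕ → Class → ℕ
counts n s = length (enumerate n s)

counts-suc : ∀ n s → counts (suc n) s ≡ step (counts n) s
counts-suc n s = trans (length-concatMap _ (transitionsInto s))
  (cong sum (map-cong (λ (s′ , c) → length-map (prependV (letter c)) (enumerate n s′)) (transitionsInto s)))

counts-step^ : ∀ k n s → counts (k ℕ.+ n) s ≡ step^ k (counts n) s
counts-step^ zero    n s = refl
counts-step^ (suc k) n s = trans (counts-suc (k ℕ.+ n) s) (step-cong (counts-step^ k n) s)

b≡total-counts : ∀ m → b (suc m) ≡ total (counts m)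
b≡total-counts m = trans (b≡length-enumerateAll m) (length-concatMap (enumerate m) classes)

b≡total-step^ : ∀ k n → b (k ℕ.+ suc n) ≡ total (step^ k (counts n))
b≡total-step^ k n = begin
  b (k ℕ.+ suc n)               ≡⟨ cong b (ℕ.+-suc k n) ⟩
  b (suc (k ℕ.+ n))             ≡⟨ b≡total-counts (k ℕ.+ n) ⟩
  total (counts (k ℕ.+ n))      ≡⟨ total-cong (counts-step^ k n) ⟩
  total (step^ k (counts n))    ∎
  where open ≡-Reasoning

b-recurrence : ∀ j → b (4 ℕ.+ j) ℕ.+ 4 ℕ.* b (2 ℕ.+ j) ℕ.+ 2 ℕ.* b j
                   ≡ 4 ℕ.* b (3 ℕ.+ j) ℕ.+ 2 ℕ.* b (1 ℕ.+ j)
-- b 0, …, b 3 normalise quickly from the definition of b; b 4 goes through the enumeration.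
b-recurrence zero    = cong (λ b₄ → b₄ ℕ.+ 4 ℕ.* b 2 ℕ.+ 2 ℕ.* b 0) (b≡total-counts 3)
b-recurrence (suc n) = begin
  b (4 ℕ.+ suc n) ℕ.+ 4 ℕ.* b (2 ℕ.+ suc n) ℕ.+ 2 ℕ.* b (suc n)
    ≡⟨ cong₂ ℕ._+_ (cong₂ (λ x y → x ℕ.+ 4 ℕ.* y) (b≡total-step^ 4 n) (b≡total-step^ 2 n))
                   (cong (2 ℕ.*_) (b≡total-counts n)) ⟩
  total (step^ 4 q) ℕ.+ 4 ℕ.* total (step^ 2 q) ℕ.+ 2 ℕ.* total q
    ≡⟨ step-recurrence q ⟩
  4 ℕ.* total (step^ 3 q) ℕ.+ 2 ℕ.* total (step^ 1 q)
    ≡⟨ cong₂ (λ y z → 4 ℕ.* y ℕ.+ 2 ℕ.* z) (b≡total-step^ 3 n) (b≡total-step^ 1 n) ⟨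
  4 ℕ.* b (3 ℕ.+ suc n) ℕ.+ 2 ℕ.* b (1 ℕ.+ suc n) ∎
  where
  open ≡-Reasoning
  q : Class → ℕ
  q = counts n

-- Generating function

sum-vanishing : ∀ (f : ℕ → ℤ) (h : ℕ → ℕ) → (∀ i → f (h i) ≡ + 0) →
                ∀ j → foldr ℤ._+_ (+ 0) (map f (applyUpTo h j)) ≡ + 0
sum-vanishing f h vanish zero    = refl
sum-vanishing f h vanish (suc j) = cong₂ ℤ._+_ (vanish 0) (sum-vanishing f (h ∘ suc) (vanish ∘ suc) j)

den-terms : ℤ → ℤ → ℤ → ℤ → ℤ → ℤ → ℤ
den-terms x₄ x₃ x₂ x₁ x₀ rest =
  + 1 ℤ.* x₄ ℤ.+ (- + 4 ℤ.* x₃ ℤ.+ (+ 4 ℤ.* x₂ ℤ.+ (- + 2 ℤ.* x₁ ℤ.+ (+ 2 ℤ.* x₀ ℤ.+ rest))))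

⋆-den : ∀ (g : Series) j →
        (den ⋆ g) (4 ℕ.+ j) ≡ den-terms (g (4 ℕ.+ j)) (g (3 ℕ.+ j)) (g (2 ℕ.+ j)) (g (1 ℕ.+ j)) (g j) (+ 0)
⋆-den g j = cong (den-terms (g (4 ℕ.+ j)) (g (3 ℕ.+ j)) (g (2 ℕ.+ j)) (g (1 ℕ.+ j)) (g j))
  (sum-vanishing (λ k → den k ℤ.* g (4 ℕ.+ j ℕ.∸ k)) (5 ℕ.+_) (λ _ → refl) j)

pos-affine : ∀ a b c → + (a ℕ.+ 4 ℕ.* b ℕ.+ 2 ℕ.* c) ≡ + a ℤ.+ + 4 ℤ.* + b ℤ.+ + 2 ℤ.* + c
pos-affine a b c = begin
  + (a ℕ.+ 4 ℕ.* b ℕ.+ 2 ℕ.* c)           ≡⟨ ℤ.pos-+ (a ℕ.+ 4 ℕ.* b) (2 ℕ.* c) ⟩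
  + (a ℕ.+ 4 ℕ.* b) ℤ.+ + (2 ℕ.* c)       ≡⟨ cong₂ ℤ._+_ (ℤ.pos-+ a (4 ℕ.* b)) (ℤ.pos-* 2 c) ⟩
  + a ℤ.+ + (4 ℕ.* b) ℤ.+ + 2 ℤ.* + c     ≡⟨ cong (λ x → + a ℤ.+ x ℤ.+ + 2 ℤ.* + c) (ℤ.pos-* 4 b) ⟩
  + a ℤ.+ + 4 ℤ.* + b ℤ.+ + 2 ℤ.* + c     ∎
  where open ≡-Reasoning

recurrence-ℕ⇒ℤ : ∀ x₀ x₁ x₂ x₃ x₄ →
                 x₄ ℕ.+ 4 ℕ.* x₂ ℕ.+ 2 ℕ.* x₀ ≡ 4 ℕ.* x₃ ℕ.+ 2 ℕ.* x₁ →
                 den-terms (+ x₄) (+ x₃) (+ x₂) (+ x₁) (+ x₀) (+ 0) ≡ + 0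
recurrence-ℕ⇒ℤ x₀ x₁ x₂ x₃ x₄ eq = begin
  den-terms (+ x₄) (+ x₃) (+ x₂) (+ x₁) (+ x₀) (+ 0)
    ≡⟨ rearrange (+ x₀) (+ x₁) (+ x₂) (+ x₃) (+ x₄) ⟩
  (+ x₄ ℤ.+ + 4 ℤ.* + x₂ ℤ.+ + 2 ℤ.* + x₀) - (+ 0 ℤ.+ + 4 ℤ.* + x₃ ℤ.+ + 2 ℤ.* + x₁)
    ≡⟨ cong₂ _-_ (pos-affine x₄ x₂ x₀) (pos-affine 0 x₃ x₁) ⟨
  + (x₄ ℕ.+ 4 ℕ.* x₂ ℕ.+ 2 ℕ.* x₀) - + (4 ℕ.* x₃ ℕ.+ 2 ℕ.* x₁)
    ≡⟨ ℤ.i≡j⇒i-j≡0 (cong +_ eq) ⟩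
  + 0 ∎
  where
  open ≡-Reasoning
  rearrange : ∀ X₀ X₁ X₂ X₃ X₄ →
    + 1 ℤ.* X₄ ℤ.+ (- + 4 ℤ.* X₃ ℤ.+ (+ 4 ℤ.* X₂ ℤ.+ (- + 2 ℤ.* X₁ ℤ.+ (+ 2 ℤ.* X₀ ℤ.+ + 0))))
    ≡ (X₄ ℤ.+ + 4 ℤ.* X₂ ℤ.+ + 2 ℤ.* X₀) - (+ 0 ℤ.+ + 4 ℤ.* X₃ ℤ.+ + 2 ℤ.* X₁)
  rearrange = solve-∀

corollary2p4 : ∀ n → (den ⋆ B) n ≡ num n
corollary2p4 0 = refl
corollary2p4 1 = refl
corollary2p4 2 = refl
corollary2p4 3 = refl
corollary2p4 (suc (suc (suc (suc j)))) = begin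
  (den ⋆ B) (4 ℕ.+ j)
    ≡⟨ ⋆-den B j ⟩
  den-terms (B (4 ℕ.+ j)) (B (3 ℕ.+ j)) (B (2 ℕ.+ j)) (B (1 ℕ.+ j)) (B j) (+ 0)
    ≡⟨ recurrence-ℕ⇒ℤ (b j) (b (1 ℕ.+ j)) (b (2 ℕ.+ j)) (b (3 ℕ.+ j)) (b (4 ℕ.+ j)) (b-recurrence j) ⟩
  + 0 ∎
  where open ≡-Reasoning
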